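{- Let $p$ be a prime and $2\le h\le r$ integers. Let $(b_1,\dots,b_\lambda)$ be a composition of $h$ with $\lambda\ge2$ blocks, $B_i=b_1+\dots+b_i$ ($B_0=0$), and let $\ell_1,\dots,\ell_h\in\{1,\dots,p-1\}$ be integers such that $\ell_{B_{i-1}+1}\ge\ell_{B_{i-1}+2}\ge\dots\ge\ell_{B_i}$ for each $1\le i\le\lambda$. Then $$\frac{1+\sum_{i=1}^h\ell_i+(p-1)\sum_{i=1}^{\lambda-1}(\lambda-i)b_i}{(p-1)\sum_{i=1}^hp^{r-i}(\ell_i+1)+(p-1)\sum_{i=1}^{\lambda-1}(\lambda-i)\sum_{j=B_{i-1}+1}^{B_i}p^{r+1-j}}<\frac{1-\frac1p+h(p-1)}{p^{r+1-h}(p^h-1)}.$$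
   Context: A composition of $h$ is a tuple of positive integers summing to $h$. The restriction on the $\ell_i$ (non-increasing within each block of the composition) is exactly the restriction encoded by a 2-level composition with outer composition $(b_1,\dots,b_\lambda)$ in the paper. -}

module Defs where

open import Data.Nat as ℕ using (ℕ; zero; suc; _+_; _∸_)
open import Data.Integer using (+_; -[1+_])
open import Data.Rational as ℚ using (ℚ; mkℚ; 0ℚ; _÷_)

⟦_⟧ : ℕ → ℚ
⟦ n ⟧ = + n ℚ./ 1

-- total division on ℚ (x / 0 = 0, as in Lean/Mathlib); all denominators
-- in the statement are positive, so this convention is never exercised.
_÷'_ : ℚ → ℚ → ℚ
x ÷' mkℚ (+ zero) _ _ = 0ℚ
x ÷' q@(mkℚ (+ suc n) _ _) = x ÷ q
x ÷' q@(mkℚ -[1+ n ] _ _) = x ÷ q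

sumFrom : ℕ → ℕ → (ℕ → ℚ) → ℚ
sumFrom a zero f = 0ℚ
sumFrom a (suc len) f = f a ℚ.+ sumFrom (suc a) len f

∑Icc : ℕ → ℕ → (ℕ → ℚ) → ℚ
∑Icc a b f = sumFrom a (suc b ∸ a) f

partial : (ℕ → ℕ) → ℕ → ℕ
partial b zero = zero
partial b (suc i) = partial b i + b (suc i)

-- Write q j = p^(r-j), S = q 1 + ⋯ + q h, and w j (multiplicity j) for the number of blocks
-- i < λ with j ≤ B i. Exchanging the order of summation turns the numerator into
-- 1 + Σ_j (ℓ_j + (p-1) w_j) and the denominator into (p-1) Σ_j q_j m_j with
-- m_j = ℓ_j + 1 + p w_j, while p^(r+1-h) (p^h - 1) = p (p-1) S turns the right-hand side into
-- (1 + hp) / (p² S). As p (ℓ_j + (p-1) w_j) ≤ (p-1) m_j, it suffices that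
-- p² S + (p-1) p S Σ_j m_j < (p-1) (1 + hp) Σ_j q_j m_j. This is a strict Chebyshev-type
-- inequality, proved by summation by parts: m is non-increasing (ℓ decreases inside a block,
-- and at a block end w drops by one, which outweighs ℓ ≤ p-1), the partial sums of q are
-- front-loaded because q decays geometrically with ratio 1/p, and m₁ ≥ p + 2 > m_h gives
-- strictness.

module Submission where

open import Defs
open import Data.Nat as ℕ using (ℕ; zero; suc; _+_; _∸_; _*_; _^_; _≤_; _<_; z≤n; s≤s)
open import Data.Nat.Properties
open import Data.Nat.Tactic.RingSolver using (solve-∀)
open import Data.Nat.Primality using (Prime)
open import Data.Rational as ℚ using (ℚ; 1ℚ)
open import Data.Product using (_×_; Σ-syntax; _,_; proj₁; proj₂)
open import Data.Sum using (inj₁; inj₂)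
open import Data.Empty using (⊥; ⊥-elim)
open import Function using (_∘_)
open import Relation.Nullary using (yes; no)
open import Relation.Binary.PropositionalEquality
  using (_≡_; refl; sym; trans; cong; cong₂; subst; subst₂; module ≡-Reasoning)

sumℕ : ℕ → ℕ → (ℕ → ℕ) → ℕ
sumℕ a zero f = 0
sumℕ a (suc n) f = f a + sumℕ (suc a) n f

PointwiseOn : (ℕ → ℕ → Set) → ℕ → ℕ → (ℕ → ℕ) → (ℕ → ℕ) → Set
PointwiseOn _R_ a n f g = ∀ j → a ≤ j → j < a + n → f j R g j

private
  empty-interval : ∀ {a k} → a ≤ k → k < a + 0 → ⊥
  empty-interval {a} {k} a≤k k<a+0 = <-irrefl refl (≤-trans (subst (k <_) (+-identityʳ a) k<a+0) a≤k)

  head-pointwise : ∀ R {a n f g} → PointwiseOn R a (suc n) f g → R (f a) (g a)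
  head-pointwise R {a} {n} h = h a ≤-refl (subst (a <_) (sym (+-suc a n)) (s≤s (m≤m+n a n)))

  tail-pointwise : ∀ R {a n f g} → PointwiseOn R a (suc n) f g → PointwiseOn R (suc a) n f g
  tail-pointwise R {a} {n} h j a<j j<a+n = h j (<⇒≤ a<j) (subst (j <_) (sym (+-suc a n)) j<a+n)

sumℕ-cong : ∀ a n {f g} → PointwiseOn _≡_ a n f g → sumℕ a n f ≡ sumℕ a n g
sumℕ-cong a zero h = refl
sumℕ-cong a (suc n) h = cong₂ _+_ (head-pointwise _≡_ h) (sumℕ-cong (suc a) n (tail-pointwise _≡_ h))

sumℕ-mono-≤ : ∀ a n {f g} → PointwiseOn _≤_ a n f g → sumℕ a n f ≤ sumℕ a n g
sumℕ-mono-≤ a zero h = ≤-refl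
sumℕ-mono-≤ a (suc n) h = +-mono-≤ (head-pointwise _≤_ h) (sumℕ-mono-≤ (suc a) n (tail-pointwise _≤_ h))

sumℕ-mono-< : ∀ a n {f g} → PointwiseOn _≤_ a n f g →
  ∀ k → a ≤ k → k < a + n → f k < g k → sumℕ a n f < sumℕ a n g
sumℕ-mono-< a zero h k a≤k k<a+0 _ = ⊥-elim (empty-interval a≤k k<a+0)
sumℕ-mono-< a (suc n) h k a≤k k<a+n fk<gk with k ≟ a
... | yes refl = +-mono-<-≤ fk<gk (sumℕ-mono-≤ (suc a) n (tail-pointwise _≤_ h))
... | no k≢a = +-mono-≤-< (head-pointwise _≤_ h)
  (sumℕ-mono-< (suc a) n (tail-pointwise _≤_ h) k (≤∧≢⇒< a≤k (k≢a ∘ sym)) (subst (k <_) (+-suc a n) k<a+n) fk<gk)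

term≤sumℕ : ∀ a n f k → a ≤ k → k < a + n → f k ≤ sumℕ a n f
term≤sumℕ a zero f k a≤k k<a+0 = ⊥-elim (empty-interval a≤k k<a+0)
term≤sumℕ a (suc n) f k a≤k k<a+n with k ≟ a
... | yes refl = m≤m+n (f a) _
... | no k≢a = ≤-trans (term≤sumℕ (suc a) n f k (≤∧≢⇒< a≤k (k≢a ∘ sym)) (subst (k <_) (+-suc a n) k<a+n))
                       (m≤n+m _ (f a))

sumℕ-const : ∀ a n c → sumℕ a n (λ _ → c) ≡ n * c
sumℕ-const a zero c = refl
sumℕ-const a (suc n) c = cong (c +_) (sumℕ-const (suc a) n c)

sumℕ-zero : ∀ a n → sumℕ a n (λ _ → 0) ≡ 0
sumℕ-zero a n = trans (sumℕ-const a n 0) (*-zeroʳ n)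

sumℕ-+ : ∀ a n f g → sumℕ a n (λ j → f j + g j) ≡ sumℕ a n f + sumℕ a n g
sumℕ-+ a zero f g = refl
sumℕ-+ a (suc n) f g = trans (cong (f a + g a +_) (sumℕ-+ (suc a) n f g)) (+-+-swap (f a) (g a) _ _)
  where
  +-+-swap : ∀ w x y z → (w + x) + (y + z) ≡ (w + y) + (x + z)
  +-+-swap = solve-∀

sumℕ-*ˡ : ∀ a n c f → sumℕ a n (λ j → c * f j) ≡ c * sumℕ a n f
sumℕ-*ˡ a zero c f = sym (*-zeroʳ c)
sumℕ-*ˡ a (suc n) c f = trans (cong (c * f a +_) (sumℕ-*ˡ (suc a) n c f)) (sym (*-distribˡ-+ c (f a) _))

sumℕ-split : ∀ a m n f → sumℕ a (m + n) f ≡ sumℕ a m f + sumℕ (a + m) n f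
sumℕ-split a zero n f = cong (λ x → sumℕ x n f) (sym (+-identityʳ a))
sumℕ-split a (suc m) n f = begin
  f a + sumℕ (suc a) (m + n) f                ≡⟨ cong (f a +_) (sumℕ-split (suc a) m n f) ⟩
  f a + (sumℕ (suc a) m f + sumℕ (suc a + m) n f) ≡⟨ sym (+-assoc (f a) _ _) ⟩
  sumℕ a (suc m) f + sumℕ (suc a + m) n f      ≡⟨ cong (λ x → sumℕ a (suc m) f + sumℕ x n f) (sym (+-suc a m)) ⟩
  sumℕ a (suc m) f + sumℕ (a + suc m) n f      ∎
  where open ≡-Reasoning

sumℕ-snoc : ∀ a n f → sumℕ a (suc n) f ≡ sumℕ a n f + f (a + n)
sumℕ-snoc a n f = begin
  sumℕ a (suc n) f                    ≡⟨ cong (λ x → sumℕ a x f) (+-comm 1 n) ⟩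
  sumℕ a (n + 1) f                    ≡⟨ sumℕ-split a n 1 f ⟩
  sumℕ a n f + (f (a + n) + 0)        ≡⟨ cong (sumℕ a n f +_) (+-identityʳ _) ⟩
  sumℕ a n f + f (a + n)              ∎
  where open ≡-Reasoning

sumℕ-swap : ∀ a m c n (F : ℕ → ℕ → ℕ) →
  sumℕ a m (λ i → sumℕ c n (F i)) ≡ sumℕ c n (λ j → sumℕ a m (λ i → F i j))
sumℕ-swap a zero c n F = sym (sumℕ-zero c n)
sumℕ-swap a (suc m) c n F = trans (cong (sumℕ c n (F a) +_) (sumℕ-swap (suc a) m c n F))
                                   (sym (sumℕ-+ c n (F a) (λ j → sumℕ (suc a) m (λ i → F i j))))

sumℕ-weighted-prefixes : ∀ μ X → sumℕ 1 μ (λ i → (suc μ ∸ i) * X i) ≡ sumℕ 1 μ (λ k → sumℕ 1 k X)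
sumℕ-weighted-prefixes zero X = refl
sumℕ-weighted-prefixes (suc μ) X = begin
  sumℕ 1 (suc μ) (λ i → (suc (suc μ) ∸ i) * X i)
    ≡⟨ sumℕ-cong 1 (suc μ) (λ i _ i<2+μ → peel i (≤-pred i<2+μ)) ⟩
  sumℕ 1 (suc μ) (λ i → (suc μ ∸ i) * X i + X i)
    ≡⟨ sumℕ-+ 1 (suc μ) (λ i → (suc μ ∸ i) * X i) X ⟩
  sumℕ 1 (suc μ) (λ i → (suc μ ∸ i) * X i) + sumℕ 1 (suc μ) X
    ≡⟨ cong (_+ sumℕ 1 (suc μ) X) (sumℕ-snoc 1 μ (λ i → (suc μ ∸ i) * X i)) ⟩
  (sumℕ 1 μ (λ i → (suc μ ∸ i) * X i) + (μ ∸ μ) * X (suc μ)) + sumℕ 1 (suc μ) X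
    ≡⟨ cong (λ c → (sumℕ 1 μ (λ i → (suc μ ∸ i) * X i) + c * X (suc μ)) + sumℕ 1 (suc μ) X) (n∸n≡0 μ) ⟩
  (sumℕ 1 μ (λ i → (suc μ ∸ i) * X i) + 0) + sumℕ 1 (suc μ) X
    ≡⟨ cong (λ s → (s + 0) + sumℕ 1 (suc μ) X) (sumℕ-weighted-prefixes μ X) ⟩
  (sumℕ 1 μ (λ k → sumℕ 1 k X) + 0) + sumℕ 1 (suc μ) X
    ≡⟨ cong (_+ sumℕ 1 (suc μ) X) (+-identityʳ (sumℕ 1 μ (λ k → sumℕ 1 k X))) ⟩
  sumℕ 1 μ (λ k → sumℕ 1 k X) + sumℕ 1 (suc μ) X
    ≡⟨ sym (sumℕ-snoc 1 μ (λ k → sumℕ 1 k X)) ⟩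
  sumℕ 1 (suc μ) (λ k → sumℕ 1 k X) ∎
  where
  open ≡-Reasoning
  peel : ∀ i → i ≤ suc μ → (suc (suc μ) ∸ i) * X i ≡ (suc μ ∸ i) * X i + X i
  peel i i≤1+μ = trans (cong (_* X i) (+-∸-assoc 1 i≤1+μ)) (+-comm (X i) _)

-- Abel summation in inequality form, with all differences moved across so that no
-- subtraction occurs: if m is non-increasing and the partial sums of f exceed those
-- of g by at least e, then Σ (f - g) m ≥ (m₁ - mₙ) e + mₙ (Fₙ - Gₙ).
sumℕ-by-parts-≤ : ∀ (f g m : ℕ → ℕ) e n →
  (∀ j → 1 ≤ j → j ≤ n → m (suc j) ≤ m j) →
  (∀ k → 1 ≤ k → k ≤ n → sumℕ 1 k g + e ≤ sumℕ 1 k f) →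
  sumℕ 1 (suc n) (λ j → g j * m j) + m 1 * e + m (suc n) * sumℕ 1 (suc n) f
    ≤ sumℕ 1 (suc n) (λ j → f j * m j) + m (suc n) * sumℕ 1 (suc n) g + m (suc n) * e
sumℕ-by-parts-≤ f g m e zero _ _ = ≤-reflexive (single (f 1) (g 1) (m 1) e)
  where
  single : ∀ f₁ g₁ m₁ e → g₁ * m₁ + 0 + m₁ * e + m₁ * (f₁ + 0) ≡ f₁ * m₁ + 0 + m₁ * (g₁ + 0) + m₁ * e
  single = solve-∀
sumℕ-by-parts-≤ f g m e (suc n) m-anti gaps = begin
  sumℕ 1 (suc N) (λ j → g j * m j) + m 1 * e + b * sumℕ 1 (suc N) f
    ≡⟨ cong₂ (λ s t → s + m 1 * e + b * t) (sumℕ-snoc 1 N (λ j → g j * m j)) (sumℕ-snoc 1 N f) ⟩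
  (Gm + g (suc N) * b) + m 1 * e + b * (F + f (suc N))
    ≡⟨ regroup-left Gm (g (suc N)) b (m 1 * e) F (f (suc N)) ⟩
  (Gm + m 1 * e + b * F) + (g (suc N) * b + b * f (suc N))
    ≤⟨ +-monoˡ-≤ _ shorter ⟩
  (Fm + b * G + b * e) + (g (suc N) * b + b * f (suc N))
    ≡⟨ regroup-right Fm G b e (g (suc N)) (f (suc N)) ⟩
  (Fm + f (suc N) * b) + b * (G + g (suc N)) + b * e
    ≡⟨ cong₂ (λ s t → s + b * t + b * e) (sym (sumℕ-snoc 1 N (λ j → f j * m j))) (sym (sumℕ-snoc 1 N g)) ⟩
  sumℕ 1 (suc N) (λ j → f j * m j) + b * sumℕ 1 (suc N) g + b * e ∎
  where
  open ≤-Reasoning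
  N = suc n
  b = m (suc N)
  d = m N ∸ b
  Gm = sumℕ 1 N (λ j → g j * m j)
  Fm = sumℕ 1 N (λ j → f j * m j)
  G = sumℕ 1 N g
  F = sumℕ 1 N f
  mN≡b+d : m N ≡ b + d
  mN≡b+d = sym (m+[n∸m]≡n (m-anti N (s≤s z≤n) ≤-refl))
  ih : Gm + m 1 * e + m N * F ≤ Fm + m N * G + m N * e
  ih = sumℕ-by-parts-≤ f g m e n (λ j 1≤j j≤n → m-anti j 1≤j (m≤n⇒m≤1+n j≤n))
                                  (λ k 1≤k k≤n → gaps k 1≤k (m≤n⇒m≤1+n k≤n))
  split-left : ∀ X b d F → X + b * F + d * F ≡ X + (b + d) * F
  split-left = solve-∀
  split-right : ∀ Fm b d G e → Fm + (b + d) * G + (b + d) * e ≡ Fm + b * G + b * e + d * (G + e)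
  split-right = solve-∀
  shorter : Gm + m 1 * e + b * F ≤ Fm + b * G + b * e
  shorter = +-cancelʳ-≤ (d * F) _ _ (begin
    Gm + m 1 * e + b * F + d * F     ≡⟨ split-left (Gm + m 1 * e) b d F ⟩
    Gm + m 1 * e + (b + d) * F       ≡⟨ cong (λ c → Gm + m 1 * e + c * F) (sym mN≡b+d) ⟩
    Gm + m 1 * e + m N * F           ≤⟨ ih ⟩
    Fm + m N * G + m N * e           ≡⟨ cong (λ c → Fm + c * G + c * e) mN≡b+d ⟩
    Fm + (b + d) * G + (b + d) * e   ≡⟨ split-right Fm b d G e ⟩
    Fm + b * G + b * e + d * (G + e) ≤⟨ +-monoʳ-≤ _ (*-monoʳ-≤ d (gaps N (s≤s z≤n) ≤-refl)) ⟩
    Fm + b * G + b * e + d * F     ∎)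
  regroup-left : ∀ Gm g' b me F f' → (Gm + g' * b) + me + b * (F + f') ≡ (Gm + me + b * F) + (g' * b + b * f')
  regroup-left = solve-∀
  regroup-right : ∀ Fm G b e g' f' → (Fm + b * G + b * e) + (g' * b + b * f') ≡ (Fm + f' * b) + b * (G + g') + b * e
  regroup-right = solve-∀

*-slack : ∀ n t Q P → 1 ≤ n → 1 ≤ t → 1 ≤ Q → 2 ≤ P →
  (1 + n * P) * (t * Q) + 1 ≤ t * P * (n * (P * Q))
*-slack (suc a) (suc b) (suc d) _ _ _ _ (s≤s (s≤s {n = c} z≤n)) =
  ≤-trans (m≤m+n _ (b + d + b * d + suc b * suc d * (2 * a + suc a * (c * c + 3 * c)))) (≤-reflexive (expand a b c d))
  where
  -- the added term is the difference of the two sides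
  expand : ∀ a b c d →
    (1 + suc a * suc (suc c)) * (suc b * suc d) + 1
      + (b + d + b * d + suc b * suc d * (2 * a + suc a * (c * c + 3 * c)))
    ≡ suc b * suc (suc c) * (suc a * (suc (suc c) * suc d))
  expand = solve-∀

endpoint-slack : ∀ p' s m₁ mₕ → 1 ≤ p' → 2 + suc p' ≤ m₁ → mₕ < m₁ →
  suc p' * suc p' * s + p' * mₕ < p' * (m₁ * (s + 1))
endpoint-slack p'@(suc c) s m₁ mₕ _ 3+c≤m₁ mₕ<m₁ = begin-strict
  suc p' * suc p' * s + p' * mₕ   <⟨ +-mono-≤-< (*-monoˡ-≤ s square≤) (*-monoʳ-< p' mₕ<m₁) ⟩
  p' * m₁ * s + p' * m₁           ≡⟨ distribute p' m₁ s ⟩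
  p' * (m₁ * (s + 1))             ∎
  where
  open ≤-Reasoning
  square≤ : suc p' * suc p' ≤ p' * m₁
  square≤ = ≤-trans (≤-trans (m≤m+n _ c) (≤-reflexive (expand c))) (*-monoʳ-≤ p' 3+c≤m₁)
    where
    expand : ∀ c → suc (suc c) * suc (suc c) + c ≡ suc c * (2 + suc (suc c))
    expand = solve-∀
  distribute : ∀ p' m s → p' * m * s + p' * m ≡ p' * (m * (s + 1))
  distribute = solve-∀

module Geometric (p' r : ℕ) where

  P : ℕ
  P = suc p'

  q : ℕ → ℕ
  q j = P ^ (r ∸ j)

  q-antitone : ∀ {i j} → i ≤ j → q j ≤ q i
  q-antitone i≤j = ^-monoʳ-≤ P (∸-monoʳ-≤ r i≤j)

  q-step : ∀ n → n < r → q n ≡ P * q (suc n)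
  q-step n n<r = cong (P ^_) (+-∸-assoc 1 n<r)

  q-positive : ∀ j → 1 ≤ q j
  q-positive j = m^n>0 P (r ∸ j)

  S : ℕ → ℕ
  S n = sumℕ 1 n q

  geometric-sum : ∀ h → h ≤ r → p' * S h + q h ≡ P ^ r
  geometric-sum zero _ = cong (_+ P ^ r) (*-zeroʳ p')
  geometric-sum (suc h) h<r = begin
    p' * S (suc h) + q (suc h)       ≡⟨ cong (λ s → p' * s + q (suc h)) (sumℕ-snoc 1 h q) ⟩
    p' * (S h + q (suc h)) + q (suc h) ≡⟨ regroup p' (S h) (q (suc h)) ⟩
    p' * S h + P * q (suc h)         ≡⟨ cong (p' * S h +_) (sym (q-step h h<r)) ⟩
    p' * S h + q h                   ≡⟨ geometric-sum h (<⇒≤ h<r) ⟩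
    P ^ r                            ∎
    where
    open ≡-Reasoning
    regroup : ∀ p' s x → p' * (s + x) + x ≡ p' * s + suc p' * x
    regroup = solve-∀

  shifted-geometric-sum : ∀ h → h ≤ r → P ^ (r + 1 ∸ h) * (P ^ h ∸ 1) ≡ P * (p' * S h)
  shifted-geometric-sum h h≤r = begin
    P ^ (r + 1 ∸ h) * (P ^ h ∸ 1)         ≡⟨ cong (λ e → P ^ e * (P ^ h ∸ 1)) (trans (+-∸-comm 1 h≤r) (+-comm (r ∸ h) 1)) ⟩
    P * q h * (P ^ h ∸ 1)                 ≡⟨ *-assoc P (q h) _ ⟩
    P * (q h * (P ^ h ∸ 1))               ≡⟨ cong (P *_) (*-distribˡ-∸ (q h) (P ^ h) 1) ⟩
    P * (q h * P ^ h ∸ q h * 1)           ≡⟨ cong₂ (λ x y → P * (x ∸ y)) q[h]*P^h≡P^r (*-identityʳ (q h)) ⟩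
    P * (P ^ r ∸ q h)                     ≡⟨ cong (λ x → P * (x ∸ q h)) (sym (geometric-sum h h≤r)) ⟩
    P * (p' * S h + q h ∸ q h)            ≡⟨ cong (P *_) (m+n∸n≡m (p' * S h) (q h)) ⟩
    P * (p' * S h)                        ∎
    where
    open ≡-Reasoning
    q[h]*P^h≡P^r : q h * P ^ h ≡ P ^ r
    q[h]*P^h≡P^r = trans (sym (^-distribˡ-+-* P (r ∸ h) h)) (cong (P ^_) (m∸n+n≡m h≤r))

  -- S h - S n ≤ (h - n) q (n + 1) while S n ≥ n q n = n P q (n + 1); as P ≥ 2,
  -- this leaves room for the + 1.
  prefix-bound : 1 ≤ p' → ∀ n h → 1 ≤ n → n < h → h ≤ r →
    n * (P * S h) + (S h + 1) ≤ (1 + h * P) * S n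
  prefix-bound 1≤p' n h 1≤n n<h h≤r = begin
    n * (P * S h) + (S h + 1)            ≡⟨ cong (λ s → n * (P * s) + (s + 1)) S[h]≡S[n]+tail ⟩
    n * (P * (S n + tail)) + (S n + tail + 1) ≡⟨ regroup n P (S n) tail ⟩
    (1 + n * P) * S n + ((1 + n * P) * tail + 1)
      ≤⟨ +-monoʳ-≤ ((1 + n * P) * S n) (+-monoˡ-≤ 1 (*-monoʳ-≤ (1 + n * P) tail≤)) ⟩
    (1 + n * P) * S n + ((1 + n * P) * (t * q (suc n)) + 1)
      ≤⟨ +-monoʳ-≤ ((1 + n * P) * S n) (*-slack n t (q (suc n)) P 1≤n (m<n⇒0<n∸m n<h) (q-positive (suc n)) (s≤s 1≤p')) ⟩
    (1 + n * P) * S n + t * P * (n * (P * q (suc n)))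
      ≤⟨ +-monoʳ-≤ ((1 + n * P) * S n) (*-monoʳ-≤ (t * P) S[n]≥) ⟩
    (1 + n * P) * S n + t * P * S n       ≡⟨ collect n t P (S n) ⟩
    (1 + (n + t) * P) * S n               ≡⟨ cong (λ x → (1 + x * P) * S n) n+t≡h ⟩
    (1 + h * P) * S n                     ∎
    where
    open ≤-Reasoning
    t = h ∸ n
    tail = sumℕ (1 + n) t q
    n+t≡h : n + t ≡ h
    n+t≡h = m+[n∸m]≡n (<⇒≤ n<h)
    S[h]≡S[n]+tail : S h ≡ S n + tail
    S[h]≡S[n]+tail = trans (cong (λ k → sumℕ 1 k q) (sym n+t≡h)) (sumℕ-split 1 n t q)
    tail≤ : tail ≤ t * q (suc n)
    tail≤ = ≤-trans (sumℕ-mono-≤ (1 + n) t {g = λ _ → q (suc n)} (λ j n<j _ → q-antitone n<j))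
                    (≤-reflexive (sumℕ-const (1 + n) t (q (suc n))))
    S[n]≥ : n * (P * q (suc n)) ≤ S n
    S[n]≥ = begin
      n * (P * q (suc n))       ≡⟨ cong (n *_) (sym (q-step n (<-≤-trans n<h h≤r))) ⟩
      n * q n                   ≡⟨ sym (sumℕ-const 1 n (q n)) ⟩
      sumℕ 1 n (λ _ → q n)      ≤⟨ sumℕ-mono-≤ 1 n (λ j _ j<1+n → q-antitone (≤-pred j<1+n)) ⟩
      S n                       ∎
    regroup : ∀ n P s u → n * (P * (s + u)) + (s + u + 1) ≡ (1 + n * P) * s + ((1 + n * P) * u + 1)
    regroup = solve-∀
    collect : ∀ n t P s → (1 + n * P) * s + t * P * s ≡ (1 + (n + t) * P) * s
    collect = solve-∀

  antitone-weighted-bound : 1 ≤ p' → ∀ h → 1 ≤ h → h ≤ r → (m : ℕ → ℕ) →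
    (∀ j → 1 ≤ j → j < h → m (suc j) ≤ m j) →
    P * S h * sumℕ 1 h m + m 1 * (S h + 1) ≤ (1 + h * P) * sumℕ 1 h (λ j → q j * m j) + m h
  antitone-weighted-bound 1≤p' (suc n) _ h≤r m m-anti = +-cancelʳ-≤ (m h * (h * P * S h + S h)) _ _ (begin
    P * S h * M + m 1 * (S h + 1) + m h * (h * P * S h + S h)
      ≡⟨ regroup-left ⟩
    sumℕ 1 h (λ j → P * S h * m j) + m 1 * (S h + 1) + m h * sumℕ 1 h f
      ≤⟨ sumℕ-by-parts-≤ f (λ _ → P * S h) m (S h + 1) n
           (λ j 1≤j j≤n → m-anti j 1≤j (s≤s j≤n))
           (λ k 1≤k k≤n → ≤-trans (≤-reflexive (cong (_+ (S h + 1)) (sumℕ-const 1 k (P * S h))))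
                          (≤-trans (prefix-bound 1≤p' k h 1≤k (s≤s k≤n) h≤r)
                                   (≤-reflexive (sym (sumℕ-*ˡ 1 k (1 + h * P) q))))) ⟩
    sumℕ 1 h (λ j → f j * m j) + m h * sumℕ 1 h (λ _ → P * S h) + m h * (S h + 1)
      ≡⟨ regroup-right ⟩
    (1 + h * P) * D + m h + m h * (h * P * S h + S h) ∎)
    where
    open ≤-Reasoning
    h = suc n
    M = sumℕ 1 h m
    D = sumℕ 1 h (λ j → q j * m j)
    f : ℕ → ℕ
    f j = (1 + h * P) * q j
    regroup-left : P * S h * M + m 1 * (S h + 1) + m h * (h * P * S h + S h)
                   ≡ sumℕ 1 h (λ j → P * S h * m j) + m 1 * (S h + 1) + m h * sumℕ 1 h f
    regroup-left = cong₂ (λ x y → x + m 1 * (S h + 1) + m h * y)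
      (sym (sumℕ-*ˡ 1 h (P * S h) m))
      (trans (factor h P (S h)) (sym (sumℕ-*ˡ 1 h (1 + h * P) q)))
      where
      factor : ∀ h P s → h * P * s + s ≡ (1 + h * P) * s
      factor = solve-∀
    regroup-right : sumℕ 1 h (λ j → f j * m j) + m h * sumℕ 1 h (λ _ → P * S h) + m h * (S h + 1)
                    ≡ (1 + h * P) * D + m h + m h * (h * P * S h + S h)
    regroup-right = begin-equality
      sumℕ 1 h (λ j → f j * m j) + m h * sumℕ 1 h (λ _ → P * S h) + m h * (S h + 1)
        ≡⟨ cong₂ (λ x y → x + m h * y + m h * (S h + 1))
             (trans (sumℕ-cong 1 h (λ j _ _ → *-assoc (1 + h * P) (q j) (m j))) (sumℕ-*ˡ 1 h (1 + h * P) (λ j → q j * m j)))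
             (sumℕ-const 1 h (P * S h)) ⟩
      (1 + h * P) * D + m h * (h * (P * S h)) + m h * (S h + 1)
        ≡⟨ rearrange ((1 + h * P) * D) (m h) h P (S h) ⟩
      (1 + h * P) * D + m h + m h * (h * P * S h + S h) ∎
      where
      rearrange : ∀ x mh h P s → x + mh * (h * (P * s)) + mh * (s + 1) ≡ x + mh + mh * (h * P * s + s)
      rearrange = solve-∀

  core-inequality : 1 ≤ p' → ∀ h → 1 ≤ h → h ≤ r → (m : ℕ → ℕ) →
    (∀ j → 1 ≤ j → j < h → m (suc j) ≤ m j) → 2 + P ≤ m 1 → m h < m 1 →
    ∀ X → P * X ≤ p' * sumℕ 1 h m →
    (1 + X) * (P * (P * (p' * S h))) < (p' + h * p' * P) * (p' * sumℕ 1 h (λ j → q j * m j))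
  core-inequality 1≤p'@(s≤s z≤n) h 1≤h h≤r m m-anti 2+P≤m₁ mₕ<m₁ X PX≤p'M = begin-strict
    (1 + X) * (P * (P * (p' * S h)))      ≡⟨ expand-left p' (S h) X ⟩
    p' * (P * P * S h + P * S h * (P * X)) ≤⟨ *-monoʳ-≤ p' (+-monoʳ-≤ (P * P * S h) (*-monoʳ-≤ (P * S h) PX≤p'M)) ⟩
    p' * (P * P * S h + P * S h * (p' * M)) <⟨ *-monoʳ-< p' bounded ⟩
    p' * (p' * ((1 + h * P) * D))          ≡⟨ expand-right p' h D ⟩
    (p' + h * p' * P) * (p' * D)           ∎
    where
    open ≤-Reasoning
    M = sumℕ 1 h m
    D = sumℕ 1 h (λ j → q j * m j)
    bounded : P * P * S h + P * S h * (p' * M) < p' * ((1 + h * P) * D)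
    bounded = +-cancelʳ-< (p' * m h) _ _ (begin-strict
      P * P * S h + P * S h * (p' * M) + p' * m h     ≡⟨ regroup (P * P * S h) (P * S h) p' M (p' * m h) ⟩
      P * P * S h + p' * m h + p' * (P * S h * M)     <⟨ +-monoˡ-< _ (endpoint-slack p' (S h) (m 1) (m h) 1≤p' 2+P≤m₁ mₕ<m₁) ⟩
      p' * (m 1 * (S h + 1)) + p' * (P * S h * M)     ≡⟨ factor-out p' (P * S h * M) (m 1 * (S h + 1)) ⟩
      p' * (P * S h * M + m 1 * (S h + 1))            ≤⟨ *-monoʳ-≤ p' (antitone-weighted-bound 1≤p' h 1≤h h≤r m m-anti) ⟩
      p' * ((1 + h * P) * D + m h)                    ≡⟨ *-distribˡ-+ p' ((1 + h * P) * D) (m h) ⟩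
      p' * ((1 + h * P) * D) + p' * m h              ∎)
      where
      regroup : ∀ a c p' M b → a + c * (p' * M) + b ≡ a + b + p' * (c * M)
      regroup = solve-∀
      factor-out : ∀ p' x y → p' * y + p' * x ≡ p' * (x + y)
      factor-out = solve-∀
    expand-left : ∀ p' s X → (1 + X) * (suc p' * (suc p' * (p' * s))) ≡ p' * (suc p' * suc p' * s + suc p' * s * (suc p' * X))
    expand-left = solve-∀
    expand-right : ∀ p' h D → p' * (p' * ((1 + h * suc p') * D)) ≡ (p' + h * p' * suc p') * (p' * D)
    expand-right = solve-∀

𝟙[_≤_] : ℕ → ℕ → ℕ
𝟙[ zero ≤ B ] = 1
𝟙[ suc j ≤ zero ] = 0
𝟙[ suc j ≤ suc B ] = 𝟙[ j ≤ B ]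

𝟙-≤ : ∀ {j B} → j ≤ B → 𝟙[ j ≤ B ] ≡ 1
𝟙-≤ {zero} _ = refl
𝟙-≤ {suc j} {suc B} (s≤s j≤B) = 𝟙-≤ j≤B

𝟙-> : ∀ {j B} → B < j → 𝟙[ j ≤ B ] ≡ 0
𝟙-> {suc j} {zero} _ = refl
𝟙-> {suc j} {suc B} (s≤s B<j) = 𝟙-> B<j

𝟙-antitone : ∀ j B → 𝟙[ suc j ≤ B ] ≤ 𝟙[ j ≤ B ]
𝟙-antitone zero zero = z≤n
𝟙-antitone zero (suc B) = ≤-refl
𝟙-antitone (suc j) zero = z≤n
𝟙-antitone (suc j) (suc B) = 𝟙-antitone j B

sumℕ-truncate : ∀ B h g → B ≤ h → sumℕ 1 h (λ j → 𝟙[ j ≤ B ] * g j) ≡ sumℕ 1 B g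
sumℕ-truncate B h g B≤h = begin
  sumℕ 1 h (λ j → 𝟙[ j ≤ B ] * g j)
    ≡⟨ cong (λ k → sumℕ 1 k (λ j → 𝟙[ j ≤ B ] * g j)) (sym (m+[n∸m]≡n B≤h)) ⟩
  sumℕ 1 (B + (h ∸ B)) (λ j → 𝟙[ j ≤ B ] * g j)
    ≡⟨ sumℕ-split 1 B (h ∸ B) _ ⟩
  sumℕ 1 B (λ j → 𝟙[ j ≤ B ] * g j) + sumℕ (1 + B) (h ∸ B) (λ j → 𝟙[ j ≤ B ] * g j)
    ≡⟨ cong₂ _+_ (sumℕ-cong 1 B (λ j _ j<1+B → trans (cong (_* g j) (𝟙-≤ (≤-pred j<1+B))) (+-identityʳ (g j))))
                 (trans (sumℕ-cong (1 + B) (h ∸ B) (λ j B<j _ → cong (_* g j) (𝟙-> B<j))) (sumℕ-zero (1 + B) (h ∸ B))) ⟩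
  sumℕ 1 B g + 0
    ≡⟨ +-identityʳ _ ⟩
  sumℕ 1 B g ∎
  where open ≡-Reasoning

sumIccℕ : ℕ → ℕ → (ℕ → ℕ) → ℕ
sumIccℕ a c g = sumℕ a (suc c ∸ a) g

module Blocks (b : ℕ → ℕ) (μ : ℕ) where

  B : ℕ → ℕ
  B = partial b

  B-mono : ∀ {k k'} → k ≤ k' → B k ≤ B k'
  B-mono {k} {zero} z≤n = ≤-refl
  B-mono {k} {suc k'} k≤1+k' with m≤n⇒m<n∨m≡n k≤1+k'
  ... | inj₁ k<1+k' = ≤-trans (B-mono (≤-pred k<1+k')) (m≤m+n (B k') (b (suc k')))
  ... | inj₂ refl = ≤-refl

  block : (ℕ → ℕ) → ℕ → ℕ
  block g i = sumIccℕ (B (i ∸ 1) + 1) (B i) g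

  block-suc : ∀ i g → block g (suc i) ≡ sumℕ (1 + B i) (b (suc i)) g
  block-suc i g = cong₂ (λ a n → sumℕ a n g) (+-comm (B i) 1) length≡
    where
    length≡ : suc (B i + b (suc i)) ∸ (B i + 1) ≡ b (suc i)
    length≡ = trans (cong (suc (B i + b (suc i)) ∸_) (+-comm (B i) 1)) (m+n∸m≡n (B i) (b (suc i)))

  sumℕ-blocks : ∀ k g → sumℕ 1 (B k) g ≡ sumℕ 1 k (block g)
  sumℕ-blocks zero g = refl
  sumℕ-blocks (suc k) g = begin
    sumℕ 1 (B k + b (suc k)) g                    ≡⟨ sumℕ-split 1 (B k) (b (suc k)) g ⟩
    sumℕ 1 (B k) g + sumℕ (1 + B k) (b (suc k)) g  ≡⟨ cong₂ _+_ (sumℕ-blocks k g) (sym (block-suc k g)) ⟩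
    sumℕ 1 k (block g) + block g (suc k)           ≡⟨ sym (sumℕ-snoc 1 k (block g)) ⟩
    sumℕ 1 (suc k) (block g)                       ∎
    where open ≡-Reasoning

  block-of : ∀ k j → 1 ≤ j → j ≤ B k → Σ[ i ∈ ℕ ] 1 ≤ i × i ≤ k × B (i ∸ 1) < j × j ≤ B i
  block-of zero j 1≤j j≤0 = ⊥-elim (<-irrefl refl (≤-trans 1≤j j≤0))
  block-of (suc k) j 1≤j j≤B[1+k] with j ≤? B k
  ... | yes j≤B[k] = let (i , 1≤i , i≤k , above , below) = block-of k j 1≤j j≤B[k]
                     in i , 1≤i , m≤n⇒m≤1+n i≤k , above , below
  ... | no j≰B[k] = suc k , s≤s z≤n , ≤-refl , ≰⇒> j≰B[k] , j≤B[1+k]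

  multiplicity : ℕ → ℕ
  multiplicity j = sumℕ 1 μ (λ i → 𝟙[ j ≤ B i ])

  weighted-blocks : ∀ h → B μ ≤ h → ∀ g →
    sumℕ 1 μ (λ i → (suc μ ∸ i) * block g i) ≡ sumℕ 1 h (λ j → multiplicity j * g j)
  weighted-blocks h B[μ]≤h g = begin
    sumℕ 1 μ (λ i → (suc μ ∸ i) * block g i)
      ≡⟨ sumℕ-weighted-prefixes μ (block g) ⟩
    sumℕ 1 μ (λ k → sumℕ 1 k (block g))
      ≡⟨ sumℕ-cong 1 μ (λ k _ k<1+μ → sym (trans (sumℕ-truncate (B k) h g (B[k]≤h (≤-pred k<1+μ))) (sumℕ-blocks k g))) ⟩
    sumℕ 1 μ (λ k → sumℕ 1 h (λ j → 𝟙[ j ≤ B k ] * g j))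
      ≡⟨ sumℕ-swap 1 μ 1 h (λ k j → 𝟙[ j ≤ B k ] * g j) ⟩
    sumℕ 1 h (λ j → sumℕ 1 μ (λ k → 𝟙[ j ≤ B k ] * g j))
      ≡⟨ sumℕ-cong 1 h (λ j _ _ → pull-out j) ⟩
    sumℕ 1 h (λ j → multiplicity j * g j) ∎
    where
    open ≡-Reasoning
    B[k]≤h : ∀ {k} → k ≤ μ → B k ≤ h
    B[k]≤h k≤μ = ≤-trans (B-mono k≤μ) B[μ]≤h
    pull-out : ∀ j → sumℕ 1 μ (λ k → 𝟙[ j ≤ B k ] * g j) ≡ multiplicity j * g j
    pull-out j = trans (sumℕ-cong 1 μ (λ k _ _ → *-comm 𝟙[ j ≤ B k ] (g j)))
                       (trans (sumℕ-*ˡ 1 μ (g j) (λ k → 𝟙[ j ≤ B k ])) (*-comm (g j) (multiplicity j)))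

  weighted-block-sizes : ∀ h → B μ ≤ h → sumℕ 1 μ (λ i → (suc μ ∸ i) * b i) ≡ sumℕ 1 h multiplicity
  weighted-block-sizes h B[μ]≤h = begin
    sumℕ 1 μ (λ i → (suc μ ∸ i) * b i)
      ≡⟨ sumℕ-cong 1 μ (λ { (suc i) _ _ → cong ((suc μ ∸ suc i) *_) (sym (block-size i)) }) ⟩
    sumℕ 1 μ (λ i → (suc μ ∸ i) * block (λ _ → 1) i)
      ≡⟨ weighted-blocks h B[μ]≤h (λ _ → 1) ⟩
    sumℕ 1 h (λ j → multiplicity j * 1)
      ≡⟨ sumℕ-cong 1 h (λ j _ _ → *-identityʳ (multiplicity j)) ⟩
    sumℕ 1 h multiplicity ∎
    where
    open ≡-Reasoning
    block-size : ∀ i → block (λ _ → 1) (suc i) ≡ b (suc i)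
    block-size i = trans (block-suc i (λ _ → 1)) (trans (sumℕ-const (1 + B i) (b (suc i)) 1) (*-identityʳ (b (suc i))))

  multiplicity-antitone : ∀ j → multiplicity (suc j) ≤ multiplicity j
  multiplicity-antitone j = sumℕ-mono-≤ 1 μ (λ i _ _ → 𝟙-antitone j (B i))

  multiplicity-drop : ∀ i → 1 ≤ i → i ≤ μ → multiplicity (suc (B i)) < multiplicity (B i)
  multiplicity-drop i 1≤i i≤μ = sumℕ-mono-< 1 μ (λ k _ _ → 𝟙-antitone (B i) (B k)) i 1≤i (s≤s i≤μ)
    (subst₂ _<_ (sym (𝟙-> {suc (B i)} {B i} ≤-refl)) (sym (𝟙-≤ {B i} ≤-refl)) (s≤s z≤n))

  multiplicity-positive : 1 ≤ μ → 1 ≤ b 1 → 1 ≤ multiplicity 1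
  multiplicity-positive 1≤μ 1≤b₁ =
    ≤-trans (≤-reflexive (sym (𝟙-≤ 1≤b₁))) (term≤sumℕ 1 μ (λ i → 𝟙[ 1 ≤ B i ]) 1 ≤-refl (s≤s 1≤μ))

  multiplicity-beyond : ∀ j → B μ < j → multiplicity j ≡ 0
  multiplicity-beyond j B[μ]<j =
    trans (sumℕ-cong 1 μ (λ i _ i<1+μ → 𝟙-> (≤-<-trans (B-mono (≤-pred i<1+μ)) B[μ]<j))) (sumℕ-zero 1 μ)

weight-bound : ∀ l p' w → l ≤ p' → suc p' * (l + p' * w) ≤ p' * (l + 1 + suc p' * w)
weight-bound l p' w l≤p' =
  subst (λ p → suc p * (l + p * w) ≤ p * (l + 1 + suc p * w)) (m+[n∸m]≡n l≤p') (expanded (p' ∸ l))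
  where
  identity : ∀ l e w → suc (l + e) * (l + (l + e) * w) + e ≡ (l + e) * (l + 1 + suc (l + e) * w)
  identity = solve-∀
  expanded : ∀ e → suc (l + e) * (l + (l + e) * w) ≤ (l + e) * (l + 1 + suc (l + e) * w)
  expanded e = ≤-trans (m≤m+n _ e) (≤-reflexive (identity l e w))

module Weights (p' : ℕ) (b : ℕ → ℕ) (μ h : ℕ) (ℓ : ℕ → ℕ) where

  open Blocks b μ

  m : ℕ → ℕ
  m j = ℓ j + 1 + suc p' * multiplicity j

  m-drop : ∀ j → ℓ (suc j) ≤ p' → multiplicity (suc j) < multiplicity j → m (suc j) ≤ m j
  m-drop j ℓ≤p' drop = begin
    ℓ (suc j) + 1 + suc p' * multiplicity (suc j) ≤⟨ +-monoˡ-≤ _ (+-monoˡ-≤ 1 ℓ≤p') ⟩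
    p' + 1 + suc p' * multiplicity (suc j)        ≡⟨ collect p' (multiplicity (suc j)) ⟩
    suc p' * suc (multiplicity (suc j))           ≤⟨ *-monoʳ-≤ (suc p') drop ⟩
    suc p' * multiplicity j                       ≤⟨ m≤n+m _ (ℓ j + 1) ⟩
    m j                                           ∎
    where
    open ≤-Reasoning
    collect : ∀ p' w → p' + 1 + suc p' * w ≡ suc p' * suc w
    collect = solve-∀

  m-antitone : B (suc μ) ≡ h → (∀ j → 1 ≤ j → j ≤ h → ℓ j ≤ p') →
    (∀ i → 1 ≤ i → i ≤ suc μ → ∀ j → B (i ∸ 1) + 1 ≤ j → j < B i → ℓ (suc j) ≤ ℓ j) →
    ∀ j → 1 ≤ j → j < h → m (suc j) ≤ m j
  m-antitone B[1+μ]≡h ℓ≤p' ℓ-antitone j 1≤j j<h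
    with block-of (suc μ) j 1≤j (subst (j ≤_) (sym B[1+μ]≡h) (<⇒≤ j<h))
  ... | i , 1≤i , i≤1+μ , above , below with m≤n⇒m<n∨m≡n below
  ...   | inj₁ j<B[i] = +-mono-≤ (+-monoˡ-≤ 1 (ℓ-antitone i 1≤i i≤1+μ j (subst (_≤ j) (+-comm 1 (B (i ∸ 1))) above) j<B[i]))
                                 (*-monoʳ-≤ (suc p') (multiplicity-antitone j))
  ...   | inj₂ refl = m-drop (B i) (ℓ≤p' (suc (B i)) (s≤s z≤n) j<h) (multiplicity-drop i 1≤i i≤μ)
    where
    i≤μ : i ≤ μ
    i≤μ with m≤n⇒m<n∨m≡n i≤1+μ
    ... | inj₁ i<1+μ = ≤-pred i<1+μ
    ... | inj₂ refl = ⊥-elim (<-irrefl B[1+μ]≡h j<h)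

  m₁-lower : 1 ≤ μ → 1 ≤ b 1 → 1 ≤ ℓ 1 → 2 + suc p' ≤ m 1
  m₁-lower 1≤μ 1≤b₁ 1≤ℓ₁ = begin
    2 + suc p'                      ≡⟨ expand p' ⟩
    1 + 1 + suc p' * 1              ≤⟨ +-mono-≤ (+-monoˡ-≤ 1 1≤ℓ₁) (*-monoʳ-≤ (suc p') (multiplicity-positive 1≤μ 1≤b₁)) ⟩
    m 1                             ∎
    where
    open ≤-Reasoning
    expand : ∀ p' → 2 + suc p' ≡ 1 + 1 + suc p' * 1
    expand = solve-∀

  mₕ<m₁ : ℓ h ≤ p' → B μ < h → 2 + suc p' ≤ m 1 → m h < m 1
  mₕ<m₁ ℓₕ≤p' B[μ]<h 2+P≤m₁ = begin-strict
    ℓ h + 1 + suc p' * multiplicity h ≡⟨ cong (λ w → ℓ h + 1 + suc p' * w) (multiplicity-beyond h B[μ]<h) ⟩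
    ℓ h + 1 + suc p' * 0              ≤⟨ +-monoˡ-≤ (suc p' * 0) (+-monoˡ-≤ 1 ℓₕ≤p') ⟩
    p' + 1 + suc p' * 0               ≡⟨ collapse p' ⟩
    suc p'                            <⟨ m<n+m (suc p') {2} (s≤s z≤n) ⟩
    2 + suc p'                        ≤⟨ 2+P≤m₁ ⟩
    m 1                               ∎
    where
    open ≤-Reasoning
    collapse : ∀ p' → p' + 1 + suc p' * 0 ≡ suc p'
    collapse = solve-∀

  numerator-bound : (∀ j → 1 ≤ j → j ≤ h → ℓ j ≤ p') →
    suc p' * sumℕ 1 h (λ j → ℓ j + p' * multiplicity j) ≤ p' * sumℕ 1 h m
  numerator-bound ℓ≤p' = begin
    suc p' * sumℕ 1 h (λ j → ℓ j + p' * multiplicity j)    ≡⟨ sym (sumℕ-*ˡ 1 h (suc p') _) ⟩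
    sumℕ 1 h (λ j → suc p' * (ℓ j + p' * multiplicity j))  ≤⟨ sumℕ-mono-≤ 1 h (λ j 1≤j j<1+h →
                                                               weight-bound (ℓ j) p' (multiplicity j) (ℓ≤p' j 1≤j (≤-pred j<1+h))) ⟩
    sumℕ 1 h (λ j → p' * m j)                               ≡⟨ sumℕ-*ˡ 1 h p' m ⟩
    p' * sumℕ 1 h m                                         ∎
    where open ≤-Reasoning

module ℕ↪ℚ where

  open import Data.Integer as ℤ using (+_)
  import Data.Integer.Properties as ℤP
  import Data.Integer.Tactic.RingSolver as ℤ-Solver
  open import Data.Nat.Coprimality as Coprimality using ()
  open import Data.Rational using (mkℚ; toℚᵘ)
  import Data.Rational.Properties as ℚP
  import Data.Rational.Unnormalised as ℚᵘ
  open import Data.Rational.Unnormalised using (mkℚᵘ; *≡*; *<*)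
  import Data.Rational.Unnormalised.Properties as ℚᵘP

  ⟦⟧≡mkℚ : ∀ n → ⟦ n ⟧ ≡ mkℚ (+ n) 0 (Coprimality.sym (Coprimality.1-coprimeTo n))
  ⟦⟧≡mkℚ n = ℚP.↥p/↧p≡p (mkℚ (+ n) 0 (Coprimality.sym (Coprimality.1-coprimeTo n)))

  toℚᵘ-⟦⟧ : ∀ n → toℚᵘ ⟦ n ⟧ ≡ mkℚᵘ (+ n) 0
  toℚᵘ-⟦⟧ n = cong toℚᵘ (⟦⟧≡mkℚ n)

  ⟦⟧-homo-+ : ∀ a b → ⟦ a + b ⟧ ≡ ⟦ a ⟧ ℚ.+ ⟦ b ⟧
  ⟦⟧-homo-+ a b = ℚP.toℚᵘ-injective (begin
    toℚᵘ ⟦ a + b ⟧                           ≡⟨ toℚᵘ-⟦⟧ (a + b) ⟩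
    mkℚᵘ (+ (a + b)) 0                       ≈⟨ *≡* (cong (ℤ._* + 1) (trans (ℤP.pos-+ a b)
                                                 (sym (cong₂ ℤ._+_ (ℤP.*-identityʳ (+ a)) (ℤP.*-identityʳ (+ b)))))) ⟩
    mkℚᵘ (+ a) 0 ℚᵘ.+ mkℚᵘ (+ b) 0           ≡⟨ sym (cong₂ ℚᵘ._+_ (toℚᵘ-⟦⟧ a) (toℚᵘ-⟦⟧ b)) ⟩
    toℚᵘ ⟦ a ⟧ ℚᵘ.+ toℚᵘ ⟦ b ⟧               ≈⟨ ℚᵘP.≃-sym (ℚP.toℚᵘ-homo-+ ⟦ a ⟧ ⟦ b ⟧) ⟩
    toℚᵘ (⟦ a ⟧ ℚ.+ ⟦ b ⟧)                   ∎)
    where open ℚᵘP.≃-Reasoning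

  ⟦⟧-homo-* : ∀ a b → ⟦ a * b ⟧ ≡ ⟦ a ⟧ ℚ.* ⟦ b ⟧
  ⟦⟧-homo-* a b = ℚP.toℚᵘ-injective (begin
    toℚᵘ ⟦ a * b ⟧                           ≡⟨ toℚᵘ-⟦⟧ (a * b) ⟩
    mkℚᵘ (+ (a * b)) 0                       ≈⟨ *≡* (cong (ℤ._* + 1) (ℤP.pos-* a b)) ⟩
    mkℚᵘ (+ a) 0 ℚᵘ.* mkℚᵘ (+ b) 0           ≡⟨ sym (cong₂ ℚᵘ._*_ (toℚᵘ-⟦⟧ a) (toℚᵘ-⟦⟧ b)) ⟩
    toℚᵘ ⟦ a ⟧ ℚᵘ.* toℚᵘ ⟦ b ⟧               ≈⟨ ℚᵘP.≃-sym (ℚP.toℚᵘ-homo-* ⟦ a ⟧ ⟦ b ⟧) ⟩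
    toℚᵘ (⟦ a ⟧ ℚ.* ⟦ b ⟧)                   ∎)
    where open ℚᵘP.≃-Reasoning

  sumFrom-⟦⟧ : ∀ a n f → sumFrom a n (λ i → ⟦ f i ⟧) ≡ ⟦ sumℕ a n f ⟧
  sumFrom-⟦⟧ a zero f = refl
  sumFrom-⟦⟧ a (suc n) f = trans (cong (⟦ f a ⟧ ℚ.+_) (sumFrom-⟦⟧ (suc a) n f)) (sym (⟦⟧-homo-+ (f a) _))

  sumFrom-cong : ∀ a n {f g : ℕ → ℚ} → (∀ i → f i ≡ g i) → sumFrom a n f ≡ sumFrom a n g
  sumFrom-cong a zero f≗g = refl
  sumFrom-cong a (suc n) f≗g = cong₂ ℚ._+_ (f≗g a) (sumFrom-cong (suc a) n f≗g)

  -- Below, mkℚᵘ (+ a) d is the fraction a / (1 + d).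
  mkℚᵘ-1-1/[1+p] : ∀ p' → mkℚᵘ (+ 1) 0 ℚᵘ.- mkℚᵘ (+ 1) p' ℚᵘ.≃ mkℚᵘ (+ p') p'
  mkℚᵘ-1-1/[1+p] p' = *≡* (trans (identity (+ p')) (cong (ℤ._*_ (+ p')) (sym (ℤP.pos-* 1 (suc p')))))
    where
    identity : ∀ x → (+ 1 ℤ.* (+ 1 ℤ.+ x) ℤ.+ ℤ.- (+ 1) ℤ.* + 1) ℤ.* (+ 1 ℤ.+ x) ≡ x ℤ.* (+ 1 ℤ.* (+ 1 ℤ.+ x))
    identity = ℤ-Solver.solve-∀

  mkℚᵘ-+-ℕ : ∀ a d c → mkℚᵘ (+ a) d ℚᵘ.+ mkℚᵘ (+ c) 0 ℚᵘ.≃ mkℚᵘ (+ (a + c * suc d)) d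
  mkℚᵘ-+-ℕ a d c = *≡* (trans (identity (+ a) (+ c) (+ suc d))
                                 (cong₂ ℤ._*_ (sym (trans (ℤP.pos-+ a (c * suc d)) (cong (ℤ._+_ (+ a)) (ℤP.pos-* c (suc d)))))
                                              (sym (ℤP.pos-* (suc d) 1))))
    where
    identity : ∀ x z u → (x ℤ.* + 1 ℤ.+ z ℤ.* u) ℤ.* u ≡ (x ℤ.+ z ℤ.* u) ℤ.* (u ℤ.* + 1)
    identity = ℤ-Solver.solve-∀

  mkℚᵘ-*-1/[1+y] : ∀ a d y → mkℚᵘ (+ a) d ℚᵘ.* mkℚᵘ (+ 1) y ℚᵘ.≃ mkℚᵘ (+ a) (y + d * suc y)
  mkℚᵘ-*-1/[1+y] a d y = *≡* (cong (ℤ._* + suc (y + d * suc y)) (ℤP.*-identityʳ (+ a)))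

  toℚᵘ-÷'-suc : ∀ x a d y → toℚᵘ x ℚᵘ.≃ mkℚᵘ (+ a) d →
    toℚᵘ (x ÷' ⟦ suc y ⟧) ℚᵘ.≃ mkℚᵘ (+ a) (y + d * suc y)
  toℚᵘ-÷'-suc x a d y x≃a/d = begin
    toℚᵘ (x ÷' ⟦ suc y ⟧)                 ≈⟨ subst (λ q → toℚᵘ (x ÷' q) ℚᵘ.≃ toℚᵘ x ℚᵘ.* mkℚᵘ (+ 1) y)
                                                   (sym (⟦⟧≡mkℚ (suc y))) (ℚP.toℚᵘ-homo-* x _) ⟩
    toℚᵘ x ℚᵘ.* mkℚᵘ (+ 1) y              ≈⟨ ℚᵘP.*-congʳ x≃a/d ⟩
    mkℚᵘ (+ a) d ℚᵘ.* mkℚᵘ (+ 1) y        ≈⟨ mkℚᵘ-*-1/[1+y] a d y ⟩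
    mkℚᵘ (+ a) (y + d * suc y)            ∎
    where open ℚᵘP.≃-Reasoning

  toℚᵘ-[1-1/p+c] : ∀ p' c → toℚᵘ (1ℚ ℚ.- (1ℚ ÷' ⟦ suc p' ⟧) ℚ.+ ⟦ c ⟧) ℚᵘ.≃ mkℚᵘ (+ (p' + c * suc p')) p'
  toℚᵘ-[1-1/p+c] p' c = begin
    toℚᵘ (1ℚ ℚ.- (1ℚ ÷' ⟦ suc p' ⟧) ℚ.+ ⟦ c ⟧)
      ≈⟨ ℚP.toℚᵘ-homo-+ (1ℚ ℚ.- (1ℚ ÷' ⟦ suc p' ⟧)) ⟦ c ⟧ ⟩
    toℚᵘ (1ℚ ℚ.- (1ℚ ÷' ⟦ suc p' ⟧)) ℚᵘ.+ toℚᵘ ⟦ c ⟧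
      ≈⟨ ℚᵘP.+-cong one-minus (ℚᵘP.≃-reflexive (toℚᵘ-⟦⟧ c)) ⟩
    mkℚᵘ (+ p') p' ℚᵘ.+ mkℚᵘ (+ c) 0
      ≈⟨ mkℚᵘ-+-ℕ p' p' c ⟩
    mkℚᵘ (+ (p' + c * suc p')) p' ∎
    where
    open ℚᵘP.≃-Reasoning
    one-minus : toℚᵘ (1ℚ ℚ.- (1ℚ ÷' ⟦ suc p' ⟧)) ℚᵘ.≃ mkℚᵘ (+ p') p'
    one-minus = begin
      toℚᵘ (1ℚ ℚ.- (1ℚ ÷' ⟦ suc p' ⟧))
        ≈⟨ ℚP.toℚᵘ-homo-+ 1ℚ (ℚ.- (1ℚ ÷' ⟦ suc p' ⟧)) ⟩
      mkℚᵘ (+ 1) 0 ℚᵘ.+ toℚᵘ (ℚ.- (1ℚ ÷' ⟦ suc p' ⟧))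
        ≈⟨ ℚᵘP.+-congʳ (mkℚᵘ (+ 1) 0) (ℚᵘP.≃-trans (ℚP.toℚᵘ-homo‿- (1ℚ ÷' ⟦ suc p' ⟧))
                                          (ℚᵘP.-‿cong (toℚᵘ-÷'-suc 1ℚ 1 0 p' ℚᵘP.≃-refl))) ⟩
      mkℚᵘ (+ 1) 0 ℚᵘ.- mkℚᵘ (+ 1) (p' + 0)
        ≡⟨ cong (λ e → mkℚᵘ (+ 1) 0 ℚᵘ.- mkℚᵘ (+ 1) e) (+-identityʳ p') ⟩
      mkℚᵘ (+ 1) 0 ℚᵘ.- mkℚᵘ (+ 1) p'
        ≈⟨ mkℚᵘ-1-1/[1+p] p' ⟩
      mkℚᵘ (+ p') p' ∎

  ⟦N⟧÷'⟦D⟧<[1-1/p+c]÷'⟦Y⟧ : ∀ N D p' c Y → 1 ≤ D → 1 ≤ Y → N * (suc p' * Y) < (p' + c * suc p') * D →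
    ⟦ N ⟧ ÷' ⟦ D ⟧ ℚ.< (1ℚ ℚ.- (1ℚ ÷' ⟦ suc p' ⟧) ℚ.+ ⟦ c ⟧) ÷' ⟦ Y ⟧
  ⟦N⟧÷'⟦D⟧<[1-1/p+c]÷'⟦Y⟧ N (suc d) p' c (suc y) _ _ lt = ℚP.toℚᵘ-cancel-<
    (ℚᵘP.<-respˡ-≃ (ℚᵘP.≃-sym left) (ℚᵘP.<-respʳ-≃ (ℚᵘP.≃-sym right) (*<* cross-multiplied)))
    where
    Z = p' + c * suc p'
    left : toℚᵘ (⟦ N ⟧ ÷' ⟦ suc d ⟧) ℚᵘ.≃ mkℚᵘ (+ N) (d + 0)
    left = toℚᵘ-÷'-suc ⟦ N ⟧ N 0 d (ℚᵘP.≃-reflexive (toℚᵘ-⟦⟧ N))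
    right : toℚᵘ ((1ℚ ℚ.- (1ℚ ÷' ⟦ suc p' ⟧) ℚ.+ ⟦ c ⟧) ÷' ⟦ suc y ⟧) ℚᵘ.≃ mkℚᵘ (+ Z) (y + p' * suc y)
    right = toℚᵘ-÷'-suc _ Z p' y (toℚᵘ-[1-1/p+c] p' c)
    cross-multiplied : + N ℤ.* + suc (y + p' * suc y) ℤ.< + Z ℤ.* + suc (d + 0)
    cross-multiplied = subst₂ ℤ._<_ (ℤP.pos-* N (suc p' * suc y))
      (trans (cong (λ e → + (Z * suc e)) (sym (+-identityʳ d))) (ℤP.pos-* Z (suc (d + 0)))) (ℤ.+<+ lt)

open ℕ↪ℚ

module Lemma5p30 (p' r h μ : ℕ) (b ℓ : ℕ → ℕ)
  (1≤p' : 1 ≤ p') (1≤μ : 1 ≤ μ) (1≤h : 1 ≤ h) (h≤r : h ≤ r)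
  (hb : ∀ i → 1 ≤ i → i ≤ suc μ → 1 ≤ b i) (hB : partial b (suc μ) ≡ h)
  (hℓ : ∀ i → 1 ≤ i → i ≤ h → 1 ≤ ℓ i × ℓ i ≤ p')
  (hmono : ∀ i → 1 ≤ i → i ≤ suc μ → ∀ j → partial b (i ∸ 1) + 1 ≤ j → j < partial b i → ℓ (suc j) ≤ ℓ j)
  where

  open Geometric p' r
  open Blocks b μ
  open Weights p' b μ h ℓ

  g : ℕ → ℕ
  g j = P ^ (r + 1 ∸ j)

  numerator denominator Y : ℕ
  numerator = 1 + sumℕ 1 h ℓ + p' * sumℕ 1 μ (λ i → (suc μ ∸ i) * b i)
  denominator = p' * sumℕ 1 h (λ i → q i * (ℓ i + 1)) + p' * sumℕ 1 μ (λ i → (suc μ ∸ i) * block g i)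
  Y = P ^ (r + 1 ∸ h) * (P ^ h ∸ 1)

  X Dm : ℕ
  X = sumℕ 1 h (λ j → ℓ j + p' * multiplicity j)
  Dm = sumℕ 1 h (λ j → q j * m j)

  B[μ]<h : B μ < h
  B[μ]<h = subst (B μ <_) hB (subst (_≤ B μ + b (suc μ)) (+-comm (B μ) 1) (+-monoʳ-≤ (B μ) (hb (suc μ) (s≤s z≤n) ≤-refl)))

  numerator≡ : numerator ≡ 1 + X
  numerator≡ = begin
    1 + sumℕ 1 h ℓ + p' * sumℕ 1 μ (λ i → (suc μ ∸ i) * b i)
      ≡⟨ cong (λ s → 1 + sumℕ 1 h ℓ + p' * s) (weighted-block-sizes h (<⇒≤ B[μ]<h)) ⟩
    1 + sumℕ 1 h ℓ + p' * sumℕ 1 h multiplicity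
      ≡⟨ +-assoc 1 (sumℕ 1 h ℓ) (p' * sumℕ 1 h multiplicity) ⟩
    1 + (sumℕ 1 h ℓ + p' * sumℕ 1 h multiplicity)
      ≡⟨ cong (λ s → 1 + (sumℕ 1 h ℓ + s)) (sym (sumℕ-*ˡ 1 h p' multiplicity)) ⟩
    1 + (sumℕ 1 h ℓ + sumℕ 1 h (λ j → p' * multiplicity j))
      ≡⟨ cong (1 +_) (sym (sumℕ-+ 1 h ℓ (λ j → p' * multiplicity j))) ⟩
    1 + sumℕ 1 h (λ j → ℓ j + p' * multiplicity j) ∎
    where open ≡-Reasoning

  denominator≡ : denominator ≡ p' * Dm
  denominator≡ = begin
    p' * sumℕ 1 h (λ j → q j * (ℓ j + 1)) + p' * sumℕ 1 μ (λ i → (suc μ ∸ i) * block g i)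
      ≡⟨ cong (λ s → p' * sumℕ 1 h (λ j → q j * (ℓ j + 1)) + p' * s) (weighted-blocks h (<⇒≤ B[μ]<h) g) ⟩
    p' * sumℕ 1 h (λ j → q j * (ℓ j + 1)) + p' * sumℕ 1 h (λ j → multiplicity j * g j)
      ≡⟨ sym (*-distribˡ-+ p' _ _) ⟩
    p' * (sumℕ 1 h (λ j → q j * (ℓ j + 1)) + sumℕ 1 h (λ j → multiplicity j * g j))
      ≡⟨ cong (p' *_) (sym (sumℕ-+ 1 h _ _)) ⟩
    p' * sumℕ 1 h (λ j → q j * (ℓ j + 1) + multiplicity j * g j)
      ≡⟨ cong (p' *_) (sumℕ-cong 1 h (λ j _ j<1+h → merge j (≤-trans (≤-pred j<1+h) h≤r))) ⟩
    p' * sumℕ 1 h (λ j → q j * m j) ∎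
    where
    open ≡-Reasoning
    factor : ∀ q l w P → q * (l + 1) + w * (P * q) ≡ q * (l + 1 + P * w)
    factor = solve-∀
    merge : ∀ j → j ≤ r → q j * (ℓ j + 1) + multiplicity j * g j ≡ q j * m j
    merge j j≤r = trans (cong (λ x → q j * (ℓ j + 1) + multiplicity j * P ^ x) (trans (+-∸-comm 1 j≤r) (+-comm (r ∸ j) 1)))
                        (factor (q j) (ℓ j) (multiplicity j) P)

  cross-multiplied : numerator * (P * Y) < (p' + h * p' * P) * denominator
  cross-multiplied = begin-strict
    numerator * (P * Y)                ≡⟨ cong₂ (λ x y → x * (P * y)) numerator≡ (shifted-geometric-sum h h≤r) ⟩
    (1 + X) * (P * (P * (p' * S h)))   <⟨ core-inequality 1≤p' h 1≤h h≤r m (m-antitone hB ℓ≤p' hmono)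
                                            m₁≥ (mₕ<m₁ (ℓ≤p' h 1≤h ≤-refl) B[μ]<h m₁≥) X (numerator-bound ℓ≤p') ⟩
    (p' + h * p' * P) * (p' * Dm)      ≡⟨ cong ((p' + h * p' * P) *_) (sym denominator≡) ⟩
    (p' + h * p' * P) * denominator    ∎
    where
    open ≤-Reasoning
    ℓ≤p' : ∀ j → 1 ≤ j → j ≤ h → ℓ j ≤ p'
    ℓ≤p' j 1≤j j≤h = proj₂ (hℓ j 1≤j j≤h)
    m₁≥ : 2 + P ≤ m 1
    m₁≥ = m₁-lower 1≤μ (hb 1 ≤-refl (s≤s z≤n)) (proj₁ (hℓ 1 ≤-refl 1≤h))

  1≤Y : 1 ≤ Y
  1≤Y = subst (1 ≤_) (sym (shifted-geometric-sum h h≤r))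
    (*-mono-≤ (s≤s (z≤n {p'})) (*-mono-≤ 1≤p' (≤-trans (q-positive 1) (term≤sumℕ 1 h q 1 ≤-refl (s≤s 1≤h)))))

  1≤denominator : 1 ≤ denominator
  1≤denominator = n≢0⇒n>0 λ denominator≡0 → n≮0 (<-≤-trans cross-multiplied
    (≤-reflexive (trans (cong ((p' + h * p' * P) *_) denominator≡0) (*-zeroʳ (p' + h * p' * P)))))

  numerator-⟦⟧ : 1ℚ ℚ.+ ∑Icc 1 h (λ i → ⟦ ℓ i ⟧) ℚ.+ ⟦ p' ⟧ ℚ.* ∑Icc 1 μ (λ i → ⟦ (suc μ ∸ i) * b i ⟧)
                 ≡ ⟦ numerator ⟧
  numerator-⟦⟧ = begin
    1ℚ ℚ.+ ∑Icc 1 h (λ i → ⟦ ℓ i ⟧) ℚ.+ ⟦ p' ⟧ ℚ.* ∑Icc 1 μ (λ i → ⟦ (suc μ ∸ i) * b i ⟧)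
      ≡⟨ cong₂ (λ x y → 1ℚ ℚ.+ x ℚ.+ ⟦ p' ⟧ ℚ.* y) (sumFrom-⟦⟧ 1 h ℓ)
               (sumFrom-⟦⟧ 1 μ (λ i → (suc μ ∸ i) * b i)) ⟩
    ⟦ 1 ⟧ ℚ.+ ⟦ L ⟧ ℚ.+ ⟦ p' ⟧ ℚ.* ⟦ W ⟧
      ≡⟨ sym (trans (⟦⟧-homo-+ (1 + L) (p' * W)) (cong₂ ℚ._+_ (⟦⟧-homo-+ 1 L) (⟦⟧-homo-* p' W))) ⟩
    ⟦ numerator ⟧ ∎
    where
    open ≡-Reasoning
    L = sumℕ 1 h ℓ
    W = sumℕ 1 μ (λ i → (suc μ ∸ i) * b i)

  denominator-⟦⟧ : ⟦ p' ⟧ ℚ.* ∑Icc 1 h (λ i → ⟦ q i * (ℓ i + 1) ⟧)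
                   ℚ.+ ⟦ p' ⟧ ℚ.* ∑Icc 1 μ (λ i → ⟦ suc μ ∸ i ⟧ ℚ.* ∑Icc (B (i ∸ 1) + 1) (B i) (λ j → ⟦ g j ⟧))
                   ≡ ⟦ denominator ⟧
  denominator-⟦⟧ = begin
    ⟦ p' ⟧ ℚ.* ∑Icc 1 h (λ i → ⟦ q i * (ℓ i + 1) ⟧)
      ℚ.+ ⟦ p' ⟧ ℚ.* ∑Icc 1 μ (λ i → ⟦ suc μ ∸ i ⟧ ℚ.* ∑Icc (B (i ∸ 1) + 1) (B i) (λ j → ⟦ g j ⟧))
      ≡⟨ cong₂ (λ x y → ⟦ p' ⟧ ℚ.* x ℚ.+ ⟦ p' ⟧ ℚ.* y) (sumFrom-⟦⟧ 1 h (λ i → q i * (ℓ i + 1)))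
               (trans (sumFrom-cong 1 μ (λ i → blocks i)) (sumFrom-⟦⟧ 1 μ (λ i → (suc μ ∸ i) * block g i))) ⟩
    ⟦ p' ⟧ ℚ.* ⟦ A ⟧ ℚ.+ ⟦ p' ⟧ ℚ.* ⟦ C ⟧
      ≡⟨ sym (trans (⟦⟧-homo-+ (p' * A) (p' * C)) (cong₂ ℚ._+_ (⟦⟧-homo-* p' A) (⟦⟧-homo-* p' C))) ⟩
    ⟦ denominator ⟧ ∎
    where
    open ≡-Reasoning
    A = sumℕ 1 h (λ i → q i * (ℓ i + 1))
    C = sumℕ 1 μ (λ i → (suc μ ∸ i) * block g i)
    blocks : ∀ i → ⟦ suc μ ∸ i ⟧ ℚ.* ∑Icc (B (i ∸ 1) + 1) (B i) (λ j → ⟦ g j ⟧)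
                   ≡ ⟦ (suc μ ∸ i) * block g i ⟧
    blocks i = trans (cong (⟦ suc μ ∸ i ⟧ ℚ.*_) (sumFrom-⟦⟧ (B (i ∸ 1) + 1) (suc (B i) ∸ (B (i ∸ 1) + 1)) g))
                     (sym (⟦⟧-homo-* (suc μ ∸ i) (block g i)))

lemma5p30 : (p h r : ℕ) → Prime p → 2 ≤ h → h ≤ r →
    (λ' : ℕ) (b : ℕ → ℕ) → 2 ≤ λ' →
    (∀ i → 1 ≤ i → i ≤ λ' → 1 ≤ b i) → partial b λ' ≡ h →
    (ℓ : ℕ → ℕ) → (∀ i → 1 ≤ i → i ≤ h → 1 ≤ ℓ i × ℓ i ≤ p ∸ 1) →
    (∀ i → 1 ≤ i → i ≤ λ' → ∀ j → partial b (i ∸ 1) + 1 ≤ j → j < partial b i → ℓ (suc j) ≤ ℓ j) →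
    ((1ℚ ℚ.+ ∑Icc 1 h (λ i → ⟦ ℓ i ⟧)
        ℚ.+ ⟦ p ∸ 1 ⟧ ℚ.* ∑Icc 1 (λ' ∸ 1) (λ i → ⟦ (λ' ∸ i) * b i ⟧))
      ÷' (⟦ p ∸ 1 ⟧ ℚ.* ∑Icc 1 h (λ i → ⟦ p ^ (r ∸ i) * (ℓ i + 1) ⟧)
        ℚ.+ ⟦ p ∸ 1 ⟧ ℚ.* ∑Icc 1 (λ' ∸ 1) (λ i → ⟦ λ' ∸ i ⟧
              ℚ.* ∑Icc (partial b (i ∸ 1) + 1) (partial b i) (λ j → ⟦ p ^ (r + 1 ∸ j) ⟧))))
    ℚ.< ((1ℚ ℚ.- (1ℚ ÷' ⟦ p ⟧) ℚ.+ ⟦ h * (p ∸ 1) ⟧)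
      ÷' ⟦ p ^ (r + 1 ∸ h) * (p ^ h ∸ 1) ⟧)
lemma5p30 0 _ _ ()
lemma5p30 1 _ _ ()
lemma5p30 (suc (suc p'')) h r _ 2≤h h≤r (suc (suc μ')) b (s≤s (s≤s z≤n)) hb hB ℓ hℓ hmono =
  subst₂ (λ x y → x ÷' y ℚ.< (1ℚ ℚ.- (1ℚ ÷' ⟦ suc (suc p'') ⟧) ℚ.+ ⟦ h * suc p'' ⟧) ÷' ⟦ Y ⟧)
    (sym numerator-⟦⟧) (sym denominator-⟦⟧)
    (⟦N⟧÷'⟦D⟧<[1-1/p+c]÷'⟦Y⟧ numerator denominator (suc p'') (h * suc p'') Y 1≤denominator 1≤Y cross-multiplied)
  where open Lemma5p30 (suc p'') r h (suc μ') b ℓ (s≤s z≤n) (s≤s z≤n) (<⇒≤ 2≤h) h≤r hb hB hℓ hmono
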